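{- Let $G$ be a connected undirected graph with $n\ge 2$ nodes and let $s,t\in V$ be distinct. Set $M=L_G$ and $b=\mathbf t=e_s-e_t$. Then $b\in\operatorname{range}(M)$ and $\mathbf t^{\top}x^{\ast}=R_G(s,t)$, where $x^{\ast}:=\frac12\sum_{\ell=0}^{\infty}(\frac12(I+D_M^{ -1}A_M^{\top}))^{\ell}D_M^{ -1}b$.
   Context: $G=(V,E)$, $V=[n]$, is undirected (possibly weighted) with symmetric adjacency matrix $A_G$, degree matrix $D_G$, and Laplacian $L_G:=D_G-A_G^{\top}=D_G-A_G$, which is SDD (symmetric, positive diagonal, diagonally dominant). For a matrix $M$, write $M=D_M-A_M^{\top}$ with $D_M$ the diagonal part of $M$ and $A_M^{\top}$ with zero diagonal. The effective resistance is $R_G(s,t):=(e_s-e_t)^{\top}L_G^{+}(e_s-e_t)$, with $^+$ the Moore–Penrose pseudoinverse.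
   Formalization: The edge weights of the graph G are rational. -}

module Defs where

open import Data.Nat using (ℕ; zero; suc) renaming (_≤_ to _≤ℕ_)
open import Data.Fin using (Fin; zero; suc)
open import Data.Rational using (ℚ; 0ℚ; 1ℚ; ½; _+_; _-_; _*_; _<_; _≤_; ∣_∣; 1/_; ≢-nonZero)
  renaming (_≟_ to _≟ℚ_)
open import Data.Fin using () renaming (_≟_ to _≟F_)
open import Data.Product using (Σ; _×_; ∃)
open import Relation.Nullary using (yes; no; ¬_)
open import Relation.Binary.PropositionalEquality using (_≡_)

Vec : ℕ → Set
Vec n = Fin n → ℚ

Mat : ℕ → Set
Mat n = Fin n → Fin n → ℚ

sumFin : ∀ {n} → (Fin n → ℚ) → ℚ
sumFin {zero}  f = 0ℚ
sumFin {suc n} f = f zero + sumFin (λ i → f (suc i))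

δ : ∀ {n} → Fin n → Fin n → ℚ
δ i j with i ≟F j
... | yes _ = 1ℚ
... | no  _ = 0ℚ

e : ∀ {n} → Fin n → Vec n
e i j = δ i j

dot : ∀ {n} → Vec n → Vec n → ℚ
dot u v = sumFin (λ i → u i * v i)

_·v_ : ∀ {n} → Mat n → Vec n → Vec n
(M ·v v) i = sumFin (λ j → M i j * v j)

_·m_ : ∀ {n} → Mat n → Mat n → Mat n
(M ·m N) i k = sumFin (λ j → M i j * N j k)

transpose : ∀ {n} → Mat n → Mat n
transpose M i j = M j i

-- Weighted undirected graph on V = Fin n: symmetric nonnegative weights,
-- no self-loops (zero diagonal).  w i j > 0 iff {i,j} is an edge.
record Graph (n : ℕ) : Set where
  field
    w        : Mat n
    w-sym    : ∀ i j → w i j ≡ w j i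
    w-nonneg : ∀ i j → 0ℚ ≤ w i j
    w-diag   : ∀ i → w i i ≡ 0ℚ

open Graph public

data Reachable {n : ℕ} (G : Graph n) : Fin n → Fin n → Set where
  here : ∀ {i} → Reachable G i i
  step : ∀ {i j k} → 0ℚ < w G i j → Reachable G j k → Reachable G i k

Connected : ∀ {n} → Graph n → Set
Connected G = ∀ i j → Reachable G i j

adj : ∀ {n} → Graph n → Mat n
adj G = w G

deg : ∀ {n} → Graph n → Vec n
deg G i = sumFin (λ j → w G i j)

laplacian : ∀ {n} → Graph n → Mat n
laplacian G i j = δ i j * deg G i - adj G i j

-- Splitting M = D_M - A_M^T: D_M the diagonal part, A_M^T zero-diagonal.
diagPart : ∀ {n} → Mat n → Vec n
diagPart M i = M i i

offDiagAT : ∀ {n} → Mat n → Mat n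
offDiagAT M i j with i ≟F j
... | yes _ = 0ℚ
... | no  _ = 0ℚ - M i j

-- reciprocal (total; only ever applied to nonzero entries here)
inv : ℚ → ℚ
inv q with q ≟ℚ 0ℚ
... | yes _ = 0ℚ
... | no q≢0 = 1/_ q {{≢-nonZero q≢0}}

Dinv· : ∀ {n} → Mat n → Vec n → Vec n
Dinv· M v i = inv (diagPart M i) * v i

lazyWalk : ∀ {n} → Mat n → Mat n
lazyWalk M i j = ½ * (δ i j + inv (diagPart M i) * offDiagAT M i j)

pow· : ∀ {n} → Mat n → ℕ → Vec n → Vec n
pow· T zero    v = v
pow· T (suc l) v = T ·v pow· T l v

partialSum : ∀ {n} → Mat n → Vec n → ℕ → Vec n
partialSum M b zero    i = 0ℚ
partialSum M b (suc N) i = partialSum M b N i + ½ * pow· (lazyWalk M) N (Dinv· M b) i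

ConvergesTo : ∀ {n} → (ℕ → Vec n) → Vec n → Set
ConvergesTo {n} s x = ∀ (ε : ℚ) → 0ℚ < ε →
  ∃ λ (N : ℕ) → ∀ (m : ℕ) → N ≤ℕ m → ∀ (i : Fin n) → ∣ s m i - x i ∣ < ε

IsSeriesSum : ∀ {n} → Mat n → Vec n → Vec n → Set
IsSeriesSum M b x = ConvergesTo (partialSum M b) x

InRange : ∀ {n} → Mat n → Vec n → Set
InRange {n} M b = ∃ λ (y : Vec n) → ∀ i → (M ·v y) i ≡ b i

IsPseudoInverse : ∀ {n} → Mat n → Mat n → Set
IsPseudoInverse {n} M P =
  (∀ i j → ((M ·m P) ·m M) i j ≡ M i j) ×
  (∀ i j → ((P ·m M) ·m P) i j ≡ P i j) ×
  (∀ i j → transpose (M ·m P) i j ≡ (M ·m P) i j) ×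
  (∀ i j → transpose (P ·m M) i j ≡ (P ·m M) i j)

chi : ∀ {n} → Fin n → Fin n → Vec n
chi s t i = e s i - e t i

-- R_G(s,t) computed from a given pseudoinverse P of L_G
effRes : ∀ {n} → Mat n → Fin n → Fin n → ℚ
effRes P s t = dot (chi s t) (P ·v chi s t)

-- Let T = ½ (I + D⁻¹ A) be the lazy random walk of G, so that T x = x - ½ D⁻¹ L x.
-- If L x = b, the partial sums of ½ Σ Tˡ D⁻¹ b telescope to x - Tᴺ x, so it suffices that
-- Tᴺ x → 0. T is stochastic and preserves the degree-weighted mean dᵀ x. On a connected
-- graph every vertex reaches a fixed vertex s within K steps, and since T is lazy, Tᴷ puts
-- weight at least some c > 0 on s from every vertex; so every K steps the interval spanned
-- by the entries shrinks by the factor 1 - c, and Tᴺ x → 0 whenever dᵀ x = 0. The same decay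
-- shows that ker L consists of the constants. Hence b - L P b, which lies in ker L because
-- L L P = L and has zero sum, is 0; x = P b minus its degree-weighted mean solves L x = b
-- with dᵀ x = 0, and bᵀ x = bᵀ P b = R(s, t) because b has zero sum.

module Submission where

open import Algebra.Bundles using (Ring)
open import Data.Fin using (Fin; zero; suc) renaming (_≟_ to _≟ᶠ_)
open import Data.Fin.Properties using (suc-injective)
import Data.Integer as ℤ
import Data.Integer.Properties as ℤ
open import Data.Nat as ℕ using (ℕ; zero; suc; z≤n; s≤s)
import Data.Nat.Properties as ℕ
open import Data.Product using (_×_; ∃; ∃₂; _,_; proj₁; proj₂)
open import Data.Rational
  using (ℚ; mkℚ; +-*-rawSemiring; *<*; 0ℚ; 1ℚ; ½; _+_; _-_; _*_; -_; _<_; _≤_; ∣_∣; _⊓_; _⊔_; toℚᵘ; positive; nonNegative; ≢-nonZero)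
  renaming (_≟_ to _≟ℚ_)
open import Data.Rational.Properties
open import Data.Rational.Unnormalised as ℚᵘ using (mkℚᵘ; *≡*)
import Data.Rational.Unnormalised.Properties as ℚᵘ
open import Data.Rational.Solver using (module +-*-Solver)
open import Data.Sum using (inj₁; inj₂)
open import Data.Empty using (⊥-elim)
open import Function using (_∘_)
open import Relation.Nullary using (yes; no; Dec)
open import Relation.Binary.PropositionalEquality

open import Algebra.Definitions.RawSemiring +-*-rawSemiring using (_^_) renaming (_×_ to _×ₙ_)
open import Algebra.Properties.Semiring.Mult (Ring.semiring +-*-ring) using (×-assoc-*; ×-comm-*)
open import Algebra.Properties.Semiring.Sum (Ring.semiring +-*-ring)
  using (sum; sum-cong-≗; sum-replicate-zero; ∑-distrib-+; ∑-comm; *-distribˡ-sum; *-distribʳ-sum)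

open import Defs

open +-*-Solver
open ≤-Reasoning

p≤q⇒0≤q-p : ∀ {p q} → p ≤ q → 0ℚ ≤ q - p
p≤q⇒0≤q-p {p} {q} p≤q = subst (_≤ q - p) (+-inverseʳ p) (+-monoˡ-≤ (- p) p≤q)

0≤q-p⇒p≤q : ∀ {p q} → 0ℚ ≤ q - p → p ≤ q
0≤q-p⇒p≤q {p} {q} 0≤q-p =
  subst₂ _≤_ (+-identityˡ p) (solve 2 (λ p q → (q :- p) :+ p := q) refl p q) (+-monoˡ-≤ p 0≤q-p)

≤-by-difference : ∀ {p q r s} → p ≤ q → q - p ≡ s - r → r ≤ s
≤-by-difference p≤q eq = 0≤q-p⇒p≤q (subst (0ℚ ≤_) eq (p≤q⇒0≤q-p p≤q))

*-nonNeg : ∀ {p q} → 0ℚ ≤ p → 0ℚ ≤ q → 0ℚ ≤ p * q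
*-nonNeg {p} {q} 0≤p 0≤q = nonNegative⁻¹ _ {{nonNeg*nonNeg⇒nonNeg p {{nonNegative 0≤p}} q {{nonNegative 0≤q}}}}

*-pos : ∀ {p q} → 0ℚ < p → 0ℚ < q → 0ℚ < p * q
*-pos {p} {q} 0<p 0<q = positive⁻¹ _ {{pos*pos⇒pos p {{positive 0<p}} q {{positive 0<q}}}}

*-monoˡ-≤-0≤ : ∀ {r p q} → 0ℚ ≤ r → p ≤ q → r * p ≤ r * q
*-monoˡ-≤-0≤ {r} 0≤r = *-monoˡ-≤-nonNeg r {{nonNegative 0≤r}}

*-cancelˡ-≡-pos : ∀ {r p q} → 0ℚ < r → r * p ≡ r * q → p ≡ q
*-cancelˡ-≡-pos {r} 0<r eq = ≤-antisym (*-cancelˡ-≤-pos r {{positive 0<r}} (≤-reflexive eq))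
                                       (*-cancelˡ-≤-pos r {{positive 0<r}} (≤-reflexive (sym eq)))

∣p∣≤q-r : ∀ {p q r} → r ≤ 0ℚ → 0ℚ ≤ q → r ≤ p → p ≤ q → ∣ p ∣ ≤ q - r
∣p∣≤q-r {p} {q} {r} r≤0 0≤q r≤p p≤q with ∣p∣≡p∨∣p∣≡-p p
... | inj₁ ∣p∣≡p  = subst (_≤ q - r) (sym ∣p∣≡p)
  (≤-by-difference (+-mono-≤ (p≤q⇒0≤q-p p≤q) (neg-antimono-≤ r≤0)) (solve 3 (λ p q r → (q :- p) :+ (:- r) :- con 0ℚ := (q :- r) :- p) refl p q r))
... | inj₂ ∣p∣≡-p = subst (_≤ q - r) (sym ∣p∣≡-p)
  (≤-by-difference (+-mono-≤ (p≤q⇒0≤q-p r≤p) 0≤q) (solve 3 (λ p q r → (p :- r) :+ q :- con 0ℚ := (q :- r) :- (:- p)) refl p q r))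

½<1 : ½ < 1ℚ
½<1 = *<* (ℤ.+<+ ℕ.≤-refl)

½*p<p : ∀ {p} → 0ℚ < p → ½ * p < p
½*p<p {p} 0<p = subst (½ * p <_) (*-identityˡ p) (*-monoˡ-<-pos p {{positive 0<p}} ½<1)

inv-pos : ∀ {q} → 0ℚ < q → 0ℚ < inv q
inv-pos {q} 0<q with q ≟ℚ 0ℚ
... | yes q≡0 = ⊥-elim (<-irrefl (sym q≡0) 0<q)
... | no  _   = positive⁻¹ _ {{1/pos⇒pos q {{positive 0<q}}}}

inv-inverseˡ : ∀ {q} → q ≢ 0ℚ → inv q * q ≡ 1ℚ
inv-inverseˡ {q} q≢0 with q ≟ℚ 0ℚ
... | yes q≡0 = ⊥-elim (q≢0 q≡0)
... | no  q≢0 = *-inverseˡ q {{≢-nonZero q≢0}}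

pos⇒≢0 : ∀ {q} → 0ℚ < q → q ≢ 0ℚ
pos⇒≢0 0<q q≡0 = <-irrefl (sym q≡0) 0<q

∣p∣<ε⇒p≡0 : ∀ p → (∀ ε → 0ℚ < ε → ∣ p ∣ < ε) → p ≡ 0ℚ
∣p∣<ε⇒p≡0 p small with 0ℚ <? ∣ p ∣
... | yes 0<∣p∣ = ⊥-elim (<-irrefl refl (small ∣ p ∣ 0<∣p∣))
... | no  0≮∣p∣ = ∣p∣≡0⇒p≡0 p (≤-antisym (≮⇒≥ 0≮∣p∣) (0≤∣p∣ p))

-- Geometric decay

^-nonNeg : ∀ {r} → 0ℚ ≤ r → ∀ k → 0ℚ ≤ r ^ k
^-nonNeg 0≤r zero    = nonNegative⁻¹ 1ℚ
^-nonNeg 0≤r (suc k) = *-nonNeg 0≤r (^-nonNeg 0≤r k)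

^-pos : ∀ {r} → 0ℚ < r → ∀ k → 0ℚ < r ^ k
^-pos 0<r zero    = positive⁻¹ 1ℚ
^-pos 0<r (suc k) = *-pos 0<r (^-pos 0<r k)

^-≤1 : ∀ {r} → 0ℚ ≤ r → r ≤ 1ℚ → ∀ k → r ^ k ≤ 1ℚ
^-≤1 0≤r r≤1 zero    = ≤-refl
^-≤1 {r} 0≤r r≤1 (suc k) =
  ≤-trans (*-monoˡ-≤-0≤ 0≤r (^-≤1 0≤r r≤1 k)) (subst (_≤ 1ℚ) (sym (*-identityʳ r)) r≤1)

×ₙ-nonNeg : ∀ {c} → 0ℚ ≤ c → ∀ j → 0ℚ ≤ j ×ₙ c
×ₙ-nonNeg 0≤c zero    = ≤-refl
×ₙ-nonNeg 0≤c (suc j) = +-mono-≤ 0≤c (×ₙ-nonNeg 0≤c j)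

bernoulli : ∀ {c} → 0ℚ ≤ c → c ≤ 1ℚ → ∀ j → (1ℚ - c) ^ j * (1ℚ + j ×ₙ c) ≤ 1ℚ
bernoulli {c} 0≤c c≤1 zero    = ≤-reflexive (solve 1 (λ c → con 1ℚ :* (con 1ℚ :+ con 0ℚ) := con 1ℚ) refl c)
bernoulli {c} 0≤c c≤1 (suc j) =
  ≤-trans (≤-by-difference (*-nonNeg (^-nonNeg (p≤q⇒0≤q-p c≤1) j) (*-nonNeg 0≤c (+-mono-≤ 0≤c (×ₙ-nonNeg 0≤c j))))
                           (identity ((1ℚ - c) ^ j) (j ×ₙ c) c))
          (bernoulli 0≤c c≤1 j)
  where
  identity : ∀ r x c → r * (c * (c + x)) - 0ℚ ≡ r * (1ℚ + x) - (1ℚ - c) * r * (1ℚ + (c + x))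
  identity = solve 3 (λ r x c → r :* (c :* (c :+ x)) :- con 0ℚ := r :* (con 1ℚ :+ x) :- (con 1ℚ :- c) :* r :* (con 1ℚ :+ (c :+ x))) refl

toℚᵘ-×ₙ-1 : ∀ j → toℚᵘ (j ×ₙ 1ℚ) ℚᵘ.≃ mkℚᵘ (ℤ.+ j) 0
toℚᵘ-×ₙ-1 zero    = *≡* refl
toℚᵘ-×ₙ-1 (suc j) = ℚᵘ.≃-trans (toℚᵘ-homo-+ 1ℚ (j ×ₙ 1ℚ)) (ℚᵘ.≃-trans (ℚᵘ.+-congʳ ℚᵘ.1ℚᵘ (toℚᵘ-×ₙ-1 j)) (*≡* numerators))
  where
  numerators : (ℤ.1ℤ ℤ.+ ℤ.+ j ℤ.* ℤ.1ℤ) ℤ.* ℤ.1ℤ ≡ ℤ.+ suc j ℤ.* ℤ.1ℤ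
  numerators = cong (λ m → (ℤ.1ℤ ℤ.+ m) ℤ.* ℤ.1ℤ) (ℤ.*-identityʳ (ℤ.+ j))

-- Compared in ℚᵘ, where j ×ₙ 1ℚ is literally the fraction j / 1.
×ₙ-1-unbounded : ∀ x → ∃ λ j → x < j ×ₙ 1ℚ
×ₙ-1-unbounded (mkℚ (ℤ.+ k) d _) = suc k , toℚᵘ-cancel-< (ℚᵘ.<-respʳ-≃ (ℚᵘ.≃-sym (toℚᵘ-×ₙ-1 (suc k))) (ℚᵘ.*<* k<))
  where
  k< : ℤ.+ k ℤ.* ℤ.+ 1 ℤ.< ℤ.+ suc k ℤ.* ℤ.+ suc d
  k< = subst₂ ℤ._<_ (sym (ℤ.*-identityʳ (ℤ.+ k))) (ℤ.pos-* (suc k) (suc d)) (ℤ.+<+ (ℕ.m≤m*n (suc k) (suc d)))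
×ₙ-1-unbounded (mkℚ ℤ.-[1+ k ] d _) = 1 , toℚᵘ-cancel-< (ℚᵘ.<-respʳ-≃ (ℚᵘ.≃-sym (toℚᵘ-×ₙ-1 1)) (ℚᵘ.*<* ℤ.-<+))

archimedean : ∀ {c} → 0ℚ < c → ∀ x → ∃ λ j → x < j ×ₙ c
archimedean {c} 0<c x with ×ₙ-1-unbounded (x * inv c)
... | j , x/c<j = j , subst₂ _<_ x/c*c≡x j×1*c≡j×c (*-monoˡ-<-pos c {{positive 0<c}} x/c<j)
  where
  x/c*c≡x : x * inv c * c ≡ x
  x/c*c≡x = trans (*-assoc x (inv c) c) (trans (cong (x *_) (inv-inverseˡ (pos⇒≢0 0<c))) (*-identityʳ x))
  j×1*c≡j×c : (j ×ₙ 1ℚ) * c ≡ j ×ₙ c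
  j×1*c≡j×c = trans (×-assoc-* j 1ℚ c) (cong (j ×ₙ_) (*-identityˡ c))

geometric-eventually-≤ : ∀ {c W ε} → 0ℚ < c → c ≤ 1ℚ → 0ℚ < ε → ∃ λ j → (1ℚ - c) ^ j * W ≤ ε
geometric-eventually-≤ {c} {W} {ε} 0<c c≤1 0<ε with archimedean (*-pos 0<ε 0<c) W
... | j , W<j×εc = j , ≤-trans (*-monoˡ-≤-0≤ (^-nonNeg (p≤q⇒0≤q-p c≤1) j) W≤ε[1+jc]) ε[1+jc]r≤ε
  where
  X = j ×ₙ c
  r = (1ℚ - c) ^ j
  W≤ε[1+jc] : W ≤ ε * (1ℚ + X)
  W≤ε[1+jc] = ≤-trans (<⇒≤ (subst (W <_) (sym (×-comm-* j ε c)) W<j×εc))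
                      (≤-by-difference (<⇒≤ 0<ε) (solve 2 (λ ε X → ε :- con 0ℚ := ε :* (con 1ℚ :+ X) :- ε :* X) refl ε X))
  ε[1+jc]r≤ε : r * (ε * (1ℚ + X)) ≤ ε
  ε[1+jc]r≤ε = subst₂ _≤_ (solve 3 (λ ε r X → ε :* (r :* (con 1ℚ :+ X)) := r :* (ε :* (con 1ℚ :+ X))) refl ε r X) (*-identityʳ ε)
                          (*-monoˡ-≤-0≤ (<⇒≤ 0<ε) (bernoulli (<⇒≤ 0<c) c≤1 j))

-- Finite sums, vectors and matrices

sumFin≡sum : ∀ {n} (f : Fin n → ℚ) → sumFin f ≡ sum f
sumFin≡sum {zero}  f = refl
sumFin≡sum {suc n} f = cong (f zero +_) (sumFin≡sum (f ∘ suc))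

sumFin-cong : ∀ {n} {f g : Fin n → ℚ} → (∀ i → f i ≡ g i) → sumFin f ≡ sumFin g
sumFin-cong {f = f} {g} f≗g rewrite sumFin≡sum f | sumFin≡sum g = sum-cong-≗ f≗g

sumFin-0 : ∀ n → sumFin {n} (λ _ → 0ℚ) ≡ 0ℚ
sumFin-0 n rewrite sumFin≡sum {n} (λ _ → 0ℚ) = sum-replicate-zero n

sumFin-+ : ∀ {n} (f g : Fin n → ℚ) → sumFin (λ i → f i + g i) ≡ sumFin f + sumFin g
sumFin-+ f g rewrite sumFin≡sum (λ i → f i + g i) | sumFin≡sum f | sumFin≡sum g = ∑-distrib-+ f g

sumFin-*ˡ : ∀ {n} (c : ℚ) (f : Fin n → ℚ) → sumFin (λ i → c * f i) ≡ c * sumFin f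
sumFin-*ˡ c f rewrite sumFin≡sum (λ i → c * f i) | sumFin≡sum f = sym (*-distribˡ-sum c f)

sumFin-*ʳ : ∀ {n} (c : ℚ) (f : Fin n → ℚ) → sumFin (λ i → f i * c) ≡ sumFin f * c
sumFin-*ʳ c f rewrite sumFin≡sum (λ i → f i * c) | sumFin≡sum f = sym (*-distribʳ-sum c f)

sumFin-comm : ∀ {m n} (f : Fin m → Fin n → ℚ) →
              sumFin (λ i → sumFin (f i)) ≡ sumFin (λ j → sumFin (λ i → f i j))
sumFin-comm f = begin-equality
  sumFin (λ i → sumFin (f i))          ≡⟨ sumFin-cong (λ i → sumFin≡sum (f i)) ⟩
  sumFin (λ i → sum (f i))             ≡⟨ sumFin≡sum (λ i → sum (f i)) ⟩
  sum (λ i → sum (f i))                ≡⟨ ∑-comm f ⟩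
  sum (λ j → sum (λ i → f i j))        ≡⟨ sumFin≡sum (λ j → sum (λ i → f i j)) ⟨
  sumFin (λ j → sum (λ i → f i j))     ≡⟨ sumFin-cong (λ j → sumFin≡sum (λ i → f i j)) ⟨
  sumFin (λ j → sumFin (λ i → f i j))  ∎

sumFin-neg : ∀ {n} (f : Fin n → ℚ) → sumFin (λ i → - f i) ≡ - sumFin f
sumFin-neg {zero}  f = refl
sumFin-neg {suc n} f = trans (cong (- f zero +_) (sumFin-neg (f ∘ suc))) (sym (neg-distrib-+ (f zero) _))

sumFin-- : ∀ {n} (f g : Fin n → ℚ) → sumFin (λ i → f i - g i) ≡ sumFin f - sumFin g
sumFin-- f g = trans (sumFin-+ f (λ i → - g i)) (cong (sumFin f +_) (sumFin-neg g))

sumFin-mono-≤ : ∀ {n} {f g : Fin n → ℚ} → (∀ i → f i ≤ g i) → sumFin f ≤ sumFin g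
sumFin-mono-≤ {zero}  f≤g = ≤-refl
sumFin-mono-≤ {suc n} f≤g = +-mono-≤ (f≤g zero) (sumFin-mono-≤ (f≤g ∘ suc))

sumFin-nonNeg : ∀ {n} {f : Fin n → ℚ} → (∀ i → 0ℚ ≤ f i) → 0ℚ ≤ sumFin f
sumFin-nonNeg {n} {f} 0≤f = subst (_≤ sumFin f) (sumFin-0 n) (sumFin-mono-≤ 0≤f)

term≤sumFin : ∀ {n} {f : Fin n → ℚ} → (∀ i → 0ℚ ≤ f i) → ∀ k → f k ≤ sumFin f
term≤sumFin {suc n} {f} 0≤f zero =
  subst (_≤ sumFin f) (+-identityʳ (f zero)) (+-monoʳ-≤ (f zero) (sumFin-nonNeg (0≤f ∘ suc)))
term≤sumFin {suc n} {f} 0≤f (suc k) =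
  subst (_≤ sumFin f) (+-identityˡ (f (suc k))) (+-mono-≤ (0≤f zero) (term≤sumFin (0≤f ∘ suc) k))

sumFin-single : ∀ {n} (f : Fin n → ℚ) i → (∀ j → j ≢ i → f j ≡ 0ℚ) → sumFin f ≡ f i
sumFin-single {suc n} f zero vanish = begin-equality
  f zero + sumFin (f ∘ suc)  ≡⟨ cong (f zero +_) (trans (sumFin-cong (λ j → vanish (suc j) (λ ()))) (sumFin-0 n)) ⟩
  f zero + 0ℚ                ≡⟨ +-identityʳ (f zero) ⟩
  f zero                     ∎
sumFin-single {suc n} f (suc i) vanish = begin-equality
  f zero + sumFin (f ∘ suc)  ≡⟨ cong₂ _+_ (vanish zero (λ ())) (sumFin-single (f ∘ suc) i (λ j j≢i → vanish (suc j) (j≢i ∘ suc-injective))) ⟩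
  0ℚ + f (suc i)             ≡⟨ +-identityˡ (f (suc i)) ⟩
  f (suc i)                  ∎

δ-refl : ∀ {n} (i : Fin n) → δ i i ≡ 1ℚ
δ-refl i with i ≟ᶠ i
... | yes _   = refl
... | no  i≢i = ⊥-elim (i≢i refl)

δ-≢ : ∀ {n} {i j : Fin n} → i ≢ j → δ i j ≡ 0ℚ
δ-≢ {i = i} {j} i≢j with i ≟ᶠ j
... | yes i≡j = ⊥-elim (i≢j i≡j)
... | no  _   = refl

δ-nonNeg : ∀ {n} (i j : Fin n) → 0ℚ ≤ δ i j
δ-nonNeg i j with i ≟ᶠ j
... | yes _ = nonNegative⁻¹ 1ℚ
... | no  _ = ≤-refl

sumFin-δ : ∀ {n} (i : Fin n) (f : Fin n → ℚ) → sumFin (λ j → δ i j * f j) ≡ f i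
sumFin-δ i f = begin-equality
  sumFin (λ j → δ i j * f j)  ≡⟨ sumFin-single _ i (λ j j≢i → trans (cong (_* f j) (δ-≢ (j≢i ∘ sym))) (*-zeroˡ (f j))) ⟩
  δ i i * f i                 ≡⟨ cong (_* f i) (δ-refl i) ⟩
  1ℚ * f i                    ≡⟨ *-identityˡ (f i) ⟩
  f i                         ∎

sumFin-chi : ∀ {n} (s t : Fin n) → sumFin (chi s t) ≡ 0ℚ
sumFin-chi s t = begin-equality
  sumFin (λ i → e s i - e t i)   ≡⟨ sumFin-- (e s) (e t) ⟩
  sumFin (e s) - sumFin (e t)    ≡⟨ cong₂ _-_ (sumFin-e s) (sumFin-e t) ⟩
  1ℚ - 1ℚ                        ≡⟨ +-inverseʳ 1ℚ ⟩
  0ℚ                             ∎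
  where
  sumFin-e : ∀ k → sumFin (e k) ≡ 1ℚ
  sumFin-e k = trans (sumFin-cong (λ j → sym (*-identityʳ (δ k j)))) (sumFin-δ k (λ _ → 1ℚ))

dot-sub-const : ∀ {n} (b y : Vec n) κ → sumFin b ≡ 0ℚ → dot b (λ i → y i - κ) ≡ dot b y
dot-sub-const b y κ Σb≡0 = begin-equality
  sumFin (λ i → b i * (y i - κ))       ≡⟨ sumFin-cong (λ i → solve 3 (λ b y κ → b :* (y :- κ) := b :* y :- b :* κ) refl (b i) (y i) κ) ⟩
  sumFin (λ i → b i * y i - b i * κ)   ≡⟨ sumFin-- (λ i → b i * y i) (λ i → b i * κ) ⟩
  dot b y - sumFin (λ i → b i * κ)     ≡⟨ cong (λ r → dot b y - r) (trans (sumFin-*ʳ κ b) (cong (_* κ) Σb≡0)) ⟩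
  dot b y - 0ℚ * κ                     ≡⟨ solve 2 (λ x κ → x :- con 0ℚ :* κ := x) refl (dot b y) κ ⟩
  dot b y                              ∎

ℕ-bounded : ∀ {m} (f : Fin m → ℕ) → ∃ λ K → ∀ i → f i ℕ.≤ K
ℕ-bounded {zero}  f = 0 , λ ()
ℕ-bounded {suc m} f with ℕ-bounded (f ∘ suc)
... | K , f≤K = f zero ℕ.⊔ K , λ { zero → ℕ.m≤m⊔n (f zero) K ; (suc i) → ℕ.m≤n⇒m≤o⊔n (f zero) (f≤K i) }

Within : ∀ {n} → ℚ → ℚ → Vec n → Set
Within lo hi z = ∀ i → lo ≤ z i × z i ≤ hi

ℚ-bounded : ∀ {n} (z : Vec n) → ∃₂ λ lo hi → Within lo hi z
ℚ-bounded {zero}  z = 0ℚ , 0ℚ , λ ()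
ℚ-bounded {suc n} z with ℚ-bounded (z ∘ suc)
... | lo , hi , within = z zero ⊓ lo , z zero ⊔ hi , λ
  { zero    → p⊓q≤p (z zero) lo , p≤p⊔q (z zero) hi
  ; (suc i) → ≤-trans (p⊓q≤q (z zero) lo) (proj₁ (within i)) , ≤-trans (proj₂ (within i)) (p≤q⊔p (z zero) hi)
  }

positive-lower-bound : ∀ {m} (f : Fin m → ℚ) → ∃ λ q → 0ℚ < q × (∀ i → 0ℚ < f i → q ≤ f i)
positive-lower-bound {zero}  f = 1ℚ , positive⁻¹ 1ℚ , λ ()
positive-lower-bound {suc m} f with positive-lower-bound (f ∘ suc) | 0ℚ <? f zero
... | q , 0<q , q≤f | no 0≮f₀ = q , 0<q , λ { zero 0<f₀ → ⊥-elim (0≮f₀ 0<f₀) ; (suc i) → q≤f i }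
... | q , 0<q , q≤f | yes 0<f₀ = f zero ⊓ q , 0<f₀⊓q , λ
  { zero    _     → p⊓q≤p (f zero) q
  ; (suc i) 0<fᵢ → ≤-trans (p⊓q≤q (f zero) q) (q≤f i 0<fᵢ)
  }
  where
  0<f₀⊓q : 0ℚ < f zero ⊓ q
  0<f₀⊓q with ⊓-sel (f zero) q
  ... | inj₁ eq = subst (0ℚ <_) (sym eq) 0<f₀
  ... | inj₂ eq = subst (0ℚ <_) (sym eq) 0<q

positive-lower-boundᴹ : ∀ {n} (M : Mat n) → ∃ λ q → 0ℚ < q × (∀ i j → 0ℚ < M i j → q ≤ M i j)
positive-lower-boundᴹ M with positive-lower-bound (λ i → proj₁ (positive-lower-bound (M i)))
... | q , 0<q , q≤ = q , 0<q , λ i j 0<Mij →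
  let (qᵢ , 0<qᵢ , qᵢ≤) = positive-lower-bound (M i) in ≤-trans (q≤ i 0<qᵢ) (qᵢ≤ j 0<Mij)

weighted-centre : ∀ {n} → Vec n → Vec n → ℚ
weighted-centre d z = dot d z * inv (sumFin d)

dot-centred≡0 : ∀ {n} (d z : Vec n) → sumFin d ≢ 0ℚ → dot d (λ i → z i - weighted-centre d z) ≡ 0ℚ
dot-centred≡0 d z Σd≢0 = begin-equality
  sumFin (λ i → d i * (z i - κ))          ≡⟨ sumFin-cong (λ i → solve 3 (λ d z κ → d :* (z :- κ) := d :* z :- d :* κ) refl (d i) (z i) κ) ⟩
  sumFin (λ i → d i * z i - d i * κ)      ≡⟨ sumFin-- (λ i → d i * z i) (λ i → d i * κ) ⟩
  dot d z - sumFin (λ i → d i * κ)        ≡⟨ cong (λ r → dot d z - r) (sumFin-*ʳ κ d) ⟩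
  dot d z - sumFin d * κ                  ≡⟨ cong (λ r → dot d z - r) (solve 3 (λ D m v → D :* (m :* v) := m :* (v :* D)) refl (sumFin d) (dot d z) (inv (sumFin d))) ⟩
  dot d z - dot d z * (inv (sumFin d) * sumFin d) ≡⟨ cong (λ r → dot d z - dot d z * r) (inv-inverseˡ Σd≢0) ⟩
  dot d z - dot d z * 1ℚ                  ≡⟨ solve 1 (λ m → m :- m :* con 1ℚ := con 0ℚ) refl (dot d z) ⟩
  0ℚ                                      ∎
  where κ = weighted-centre d z

weighted-mean-zero⇒lo≤0≤hi : ∀ {n} {d y : Vec n} {lo hi} → (∀ i → 0ℚ ≤ d i) → 0ℚ < sumFin d →
  dot d y ≡ 0ℚ → Within lo hi y → lo ≤ 0ℚ × 0ℚ ≤ hi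
weighted-mean-zero⇒lo≤0≤hi {d = d} {y} {lo} {hi} 0≤d 0<Σd dy≡0 within =
  *-cancelˡ-≤-pos (sumFin d) {{positive 0<Σd}} Σd*lo≤0 , *-cancelˡ-≤-pos (sumFin d) {{positive 0<Σd}} 0≤Σd*hi
  where
  Σd*lo≤0 : sumFin d * lo ≤ sumFin d * 0ℚ
  Σd*lo≤0 = begin
    sumFin d * lo               ≡⟨ sumFin-*ʳ lo d ⟨
    sumFin (λ i → d i * lo)     ≤⟨ sumFin-mono-≤ (λ i → *-monoˡ-≤-0≤ (0≤d i) (proj₁ (within i))) ⟩
    dot d y                     ≡⟨ dy≡0 ⟩
    0ℚ                          ≡⟨ *-zeroʳ (sumFin d) ⟨
    sumFin d * 0ℚ               ∎
  0≤Σd*hi : sumFin d * 0ℚ ≤ sumFin d * hi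
  0≤Σd*hi = begin
    sumFin d * 0ℚ               ≡⟨ *-zeroʳ (sumFin d) ⟩
    0ℚ                          ≡⟨ dy≡0 ⟨
    dot d y                     ≤⟨ sumFin-mono-≤ (λ i → *-monoˡ-≤-0≤ (0≤d i) (proj₂ (within i))) ⟩
    sumFin (λ i → d i * hi)     ≡⟨ sumFin-*ʳ hi d ⟩
    sumFin d * hi               ∎

·v-congʳ : ∀ {n} (M : Mat n) {u v : Vec n} → (∀ j → u j ≡ v j) → ∀ i → (M ·v u) i ≡ (M ·v v) i
·v-congʳ M u≗v i = sumFin-cong (λ j → cong (M i j *_) (u≗v j))

·v-congˡ : ∀ {n} {M N : Mat n} (v : Vec n) → (∀ i j → M i j ≡ N i j) → ∀ i → (M ·v v) i ≡ (N ·v v) i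
·v-congˡ v M≡N i = sumFin-cong (λ j → cong (_* v j) (M≡N i j))

·v-·m : ∀ {n} (M N : Mat n) (v : Vec n) i → (M ·v (N ·v v)) i ≡ ((M ·m N) ·v v) i
·v-·m M N v i = begin-equality
  sumFin (λ j → M i j * sumFin (λ l → N j l * v l))    ≡⟨ sumFin-cong (λ j → sym (sumFin-*ˡ (M i j) (λ l → N j l * v l))) ⟩
  sumFin (λ j → sumFin (λ l → M i j * (N j l * v l)))  ≡⟨ sumFin-comm (λ j l → M i j * (N j l * v l)) ⟩
  sumFin (λ l → sumFin (λ j → M i j * (N j l * v l)))  ≡⟨ sumFin-cong (λ l → sumFin-cong (λ j → sym (*-assoc (M i j) (N j l) (v l)))) ⟩
  sumFin (λ l → sumFin (λ j → M i j * N j l * v l))    ≡⟨ sumFin-cong (λ l → sumFin-*ʳ (v l) (λ j → M i j * N j l)) ⟩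
  sumFin (λ l → (M ·m N) i l * v l)                    ∎

·v-sub : ∀ {n} (M : Mat n) (x y : Vec n) i → (M ·v (λ j → x j - y j)) i ≡ (M ·v x) i - (M ·v y) i
·v-sub M x y i = begin-equality
  sumFin (λ j → M i j * (x j - y j))            ≡⟨ sumFin-cong (λ j → solve 3 (λ m x y → m :* (x :- y) := m :* x :- m :* y) refl (M i j) (x j) (y j)) ⟩
  sumFin (λ j → M i j * x j - M i j * y j)      ≡⟨ sumFin-- (λ j → M i j * x j) (λ j → M i j * y j) ⟩
  (M ·v x) i - (M ·v y) i                       ∎

·v-linear : ∀ {n} (M : Mat n) (a b : ℚ) (x y : Vec n) i →
            (M ·v (λ j → a * x j + b * y j)) i ≡ a * (M ·v x) i + b * (M ·v y) i
·v-linear M a b x y i = begin-equality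
  sumFin (λ j → M i j * (a * x j + b * y j))                    ≡⟨ sumFin-cong (λ j → distrib (M i j) a b (x j) (y j)) ⟩
  sumFin (λ j → a * (M i j * x j) + b * (M i j * y j))          ≡⟨ sumFin-+ (λ j → a * (M i j * x j)) (λ j → b * (M i j * y j)) ⟩
  sumFin (λ j → a * (M i j * x j)) + sumFin (λ j → b * (M i j * y j))
                                                                 ≡⟨ cong₂ _+_ (sumFin-*ˡ a (λ j → M i j * x j)) (sumFin-*ˡ b (λ j → M i j * y j)) ⟩
  a * (M ·v x) i + b * (M ·v y) i                               ∎
  where
  distrib : ∀ m a b x y → m * (a * x + b * y) ≡ a * (m * x) + b * (m * y)
  distrib = solve 5 (λ m a b x y → m :* (a :* x :+ b :* y) := a :* (m :* x) :+ b :* (m :* y)) refl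

pow·-congʳ : ∀ {n} (M : Mat n) k {u v : Vec n} → (∀ j → u j ≡ v j) → ∀ i → pow· M k u i ≡ pow· M k v i
pow·-congʳ M zero    u≗v = u≗v
pow·-congʳ M (suc k) u≗v = ·v-congʳ M (pow·-congʳ M k u≗v)

pow·-+ : ∀ {n} (M : Mat n) k l (v : Vec n) i → pow· M (k ℕ.+ l) v i ≡ pow· M k (pow· M l v) i
pow·-+ M zero    l v i = refl
pow·-+ M (suc k) l v   = ·v-congʳ M (pow·-+ M k l v)

pow·-sucʳ : ∀ {n} (M : Mat n) k (v : Vec n) i → pow· M k (M ·v v) i ≡ pow· M (suc k) v i
pow·-sucʳ M zero    v i = refl
pow·-sucʳ M (suc k) v   = ·v-congʳ M (pow·-sucʳ M k v)

pow·-linear : ∀ {n} (M : Mat n) k (a b : ℚ) (x y : Vec n) i →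
              pow· M k (λ j → a * x j + b * y j) i ≡ a * pow· M k x i + b * pow· M k y i
pow·-linear M zero    a b x y i = refl
pow·-linear M (suc k) a b x y i =
  trans (·v-congʳ M (pow·-linear M k a b x y) i) (·v-linear M a b (pow· M k x) (pow· M k y) i)

pow·-neg : ∀ {n} (M : Mat n) k (x : Vec n) i → pow· M k (λ j → - x j) i ≡ - pow· M k x i
pow·-neg M k x i = begin-equality
  pow· M k (λ j → - x j) i                         ≡⟨ pow·-congʳ M k (λ j → as-combination (x j)) i ⟩
  pow· M k (λ j → - 1ℚ * x j + 0ℚ * x j) i         ≡⟨ pow·-linear M k (- 1ℚ) 0ℚ x x i ⟩
  - 1ℚ * pow· M k x i + 0ℚ * pow· M k x i          ≡⟨ as-combination (pow· M k x i) ⟨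
  - pow· M k x i                                   ∎
  where
  as-combination : ∀ p → - p ≡ - 1ℚ * p + 0ℚ * p
  as-combination = solve 1 (λ p → :- p := con (- 1ℚ) :* p :+ con 0ℚ :* p) refl

pow·-fixed : ∀ {n} (M : Mat n) {u : Vec n} → (∀ i → (M ·v u) i ≡ u i) → ∀ k i → pow· M k u i ≡ u i
pow·-fixed M Mu≡u zero    i = refl
pow·-fixed M Mu≡u (suc k) i = trans (·v-congʳ M (pow·-fixed M Mu≡u k) i) (Mu≡u i)

symmetric-pseudoInverse : ∀ {n} {M P : Mat n} → (∀ i j → M i j ≡ M j i) → IsPseudoInverse M P →
  ∀ i j → (M ·m (M ·m P)) i j ≡ M i j
symmetric-pseudoInverse {M = M} {P} M-sym (MPM≡M , _ , MP-sym , _) i j = begin-equality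
  sumFin (λ k → M i k * (M ·m P) k j)   ≡⟨ sumFin-cong (λ k → cong₂ _*_ (M-sym i k) (MP-sym j k)) ⟩
  sumFin (λ k → M k i * (M ·m P) j k)   ≡⟨ sumFin-cong (λ k → *-comm (M k i) ((M ·m P) j k)) ⟩
  ((M ·m P) ·m M) j i                   ≡⟨ MPM≡M j i ⟩
  M j i                                 ≡⟨ M-sym j i ⟩
  M i j                                 ∎

constant-limit : ∀ {n} {x y : Vec n} → ConvergesTo (λ _ → x) y → ∀ i → x i ≡ y i
constant-limit {x = x} {y} x→y i = begin-equality
  x i                  ≡⟨ solve 2 (λ x y → x := (x :- y) :+ y) refl (x i) (y i) ⟩
  (x i - y i) + y i    ≡⟨ cong (_+ y i) (∣p∣<ε⇒p≡0 (x i - y i) (λ ε 0<ε → let (N , close) = x→y ε 0<ε in close N ℕ.≤-refl i)) ⟩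
  0ℚ + y i             ≡⟨ +-identityˡ (y i) ⟩
  y i                  ∎

ConvergesTo-by-distance : ∀ {n} {s t : ℕ → Vec n} {x y : Vec n} →
  (∀ m i → ∣ s m i - x i ∣ ≡ ∣ t m i - y i ∣) → ConvergesTo t y → ConvergesTo s x
ConvergesTo-by-distance same t→y ε 0<ε with t→y ε 0<ε
... | N , close = N , λ m N≤m i → subst (_< ε) (sym (same m i)) (close m N≤m i)

partialSum-telescopes : ∀ {n} (M : Mat n) (b x : Vec n) →
  (∀ i → (lazyWalk M ·v x) i ≡ x i - ½ * Dinv· M b i) →
  ∀ N i → partialSum M b N i ≡ x i - pow· (lazyWalk M) N x i
partialSum-telescopes M b x Tx≡x-½v zero    i = sym (+-inverseʳ (x i))
partialSum-telescopes M b x Tx≡x-½v (suc N) i = begin-equality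
  partialSum M b N i + ½ * Tᴺ v i              ≡⟨ cong (_+ ½ * Tᴺ v i) (partialSum-telescopes M b x Tx≡x-½v N i) ⟩
  x i - Tᴺ x i + ½ * Tᴺ v i                    ≡⟨ regroup (x i) (Tᴺ x i) (Tᴺ v i) ⟩
  x i - (1ℚ * Tᴺ x i + - ½ * Tᴺ v i)           ≡⟨ cong (λ r → x i - r) (pow·-linear T N 1ℚ (- ½) x v i) ⟨
  x i - Tᴺ (λ j → 1ℚ * x j + - ½ * v j) i      ≡⟨ cong (λ r → x i - r) (pow·-congʳ T N (λ j → trans (combination (x j) (v j)) (sym (Tx≡x-½v j))) i) ⟩
  x i - Tᴺ (T ·v x) i                          ≡⟨ cong (λ r → x i - r) (pow·-sucʳ T N x i) ⟩
  x i - pow· T (suc N) x i                     ∎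
  where
  T = lazyWalk M
  v = Dinv· M b
  Tᴺ = pow· T N
  regroup : ∀ x p q → x - p + ½ * q ≡ x - (1ℚ * p + - ½ * q)
  regroup = solve 3 (λ x p q → x :- p :+ con ½ :* q := x :- (con 1ℚ :* p :+ con (- ½) :* q)) refl
  combination : ∀ x v → 1ℚ * x + - ½ * v ≡ x - ½ * v
  combination = solve 2 (λ x v → con 1ℚ :* x :+ con (- ½) :* v := x :- con ½ :* v) refl

-- The graph Laplacian and its lazy random walk

reachable-distinct⇒deg-pos : ∀ {n} (G : Graph n) {i j} → Reachable G i j → i ≢ j → 0ℚ < deg G i
reachable-distinct⇒deg-pos G here                       i≢i = ⊥-elim (i≢i refl)
reachable-distinct⇒deg-pos G {i} (step {j = k} 0<wᵢₖ _) _   = <-≤-trans 0<wᵢₖ (term≤sumFin (w-nonneg G i) k)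

module GraphLaplacian {n : ℕ} (G : Graph n) where

  private
    L = laplacian G
    d = deg G

  laplacian-diag : ∀ i → L i i ≡ d i
  laplacian-diag i = begin-equality
    δ i i * d i - w G i i  ≡⟨ cong₂ (λ δᵢᵢ wᵢᵢ → δᵢᵢ * d i - wᵢᵢ) (δ-refl i) (w-diag G i) ⟩
    1ℚ * d i - 0ℚ          ≡⟨ solve 1 (λ x → con 1ℚ :* x :- con 0ℚ := x) refl (d i) ⟩
    d i                    ∎

  laplacian-offDiag : ∀ {i j} → i ≢ j → L i j ≡ - w G i j
  laplacian-offDiag {i} {j} i≢j = begin-equality
    δ i j * d i - w G i j  ≡⟨ cong (λ δᵢⱼ → δᵢⱼ * d i - w G i j) (δ-≢ i≢j) ⟩
    0ℚ * d i - w G i j     ≡⟨ solve 2 (λ x y → con 0ℚ :* x :- y := :- y) refl (d i) (w G i j) ⟩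
    - w G i j              ∎

  laplacian-sym : ∀ i j → L i j ≡ L j i
  laplacian-sym i j = by-cases (i ≟ᶠ j)
    where
    by-cases : Dec (i ≡ j) → L i j ≡ L j i
    by-cases (yes refl) = refl
    by-cases (no  i≢j)  = trans (laplacian-offDiag i≢j) (trans (cong -_ (w-sym G i j)) (sym (laplacian-offDiag (i≢j ∘ sym))))

  offDiagAT-laplacian : ∀ i j → offDiagAT L i j ≡ w G i j
  offDiagAT-laplacian i j with i ≟ᶠ j
  ... | yes refl = sym (w-diag G i)
  ... | no  i≢j  = trans (cong (λ r → 0ℚ - r) (laplacian-offDiag i≢j)) (solve 1 (λ y → con 0ℚ :- :- y := y) refl (w G i j))

  laplacian-·v : ∀ z i → (L ·v z) i ≡ d i * z i - (adj G ·v z) i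
  laplacian-·v z i = begin-equality
    sumFin (λ j → (δ i j * d i - w G i j) * z j)            ≡⟨ sumFin-cong (λ j → expand (δ i j) (d i) (w G i j) (z j)) ⟩
    sumFin (λ j → d i * (δ i j * z j) - w G i j * z j)      ≡⟨ sumFin-- (λ j → d i * (δ i j * z j)) (λ j → w G i j * z j) ⟩
    sumFin (λ j → d i * (δ i j * z j)) - (adj G ·v z) i     ≡⟨ cong (_- (adj G ·v z) i) (sumFin-*ˡ (d i) (λ j → δ i j * z j)) ⟩
    d i * sumFin (λ j → δ i j * z j) - (adj G ·v z) i       ≡⟨ cong (λ r → d i * r - (adj G ·v z) i) (sumFin-δ i z) ⟩
    d i * z i - (adj G ·v z) i                              ∎
    where
    expand : ∀ δ x w z → (δ * x - w) * z ≡ x * (δ * z) - w * z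
    expand = solve 4 (λ δ x w z → (δ :* x :- w) :* z := x :* (δ :* z) :- w :* z) refl

  laplacian-·v-const : ∀ κ i → (L ·v (λ _ → κ)) i ≡ 0ℚ
  laplacian-·v-const κ i = begin-equality
    (L ·v (λ _ → κ)) i     ≡⟨ laplacian-·v (λ _ → κ) i ⟩
    d i * κ - (adj G ·v (λ _ → κ)) i ≡⟨ cong (λ r → d i * κ - r) (sumFin-*ʳ κ (w G i)) ⟩
    d i * κ - d i * κ      ≡⟨ +-inverseʳ (d i * κ) ⟩
    0ℚ                     ∎

  laplacian-·v-shift : ∀ z κ i → (L ·v (λ j → z j - κ)) i ≡ (L ·v z) i
  laplacian-·v-shift z κ i = begin-equality
    (L ·v (λ j → z j - κ)) i               ≡⟨ ·v-sub L z (λ _ → κ) i ⟩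
    (L ·v z) i - (L ·v (λ _ → κ)) i        ≡⟨ cong (λ r → (L ·v z) i - r) (laplacian-·v-const κ i) ⟩
    (L ·v z) i - 0ℚ                        ≡⟨ +-identityʳ ((L ·v z) i) ⟩
    (L ·v z) i                             ∎

  sumFin-laplacian-·v : ∀ z → sumFin (L ·v z) ≡ 0ℚ
  sumFin-laplacian-·v z = begin-equality
    sumFin (λ i → sumFin (λ j → L i j * z j))   ≡⟨ sumFin-comm (λ i j → L i j * z j) ⟩
    sumFin (λ j → sumFin (λ i → L i j * z j))   ≡⟨ sumFin-cong (λ j → sumFin-*ʳ (z j) (λ i → L i j)) ⟩
    sumFin (λ j → sumFin (λ i → L i j) * z j)   ≡⟨ sumFin-cong (λ j → cong (_* z j) column-sum≡0) ⟩
    sumFin (λ j → 0ℚ * z j)                     ≡⟨ sumFin-cong (λ j → *-zeroˡ (z j)) ⟩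
    sumFin {n} (λ _ → 0ℚ)                       ≡⟨ sumFin-0 n ⟩
    0ℚ                                          ∎
    where
    column-sum≡0 : ∀ {j} → sumFin (λ i → L i j) ≡ 0ℚ
    column-sum≡0 {j} = trans (sumFin-cong (λ i → trans (laplacian-sym i j) (sym (*-identityʳ (L j i))))) (laplacian-·v-const 1ℚ j)

  sumFin-adj-·v : ∀ z → sumFin (adj G ·v z) ≡ dot d z
  sumFin-adj-·v z = begin-equality
    sumFin (λ i → sumFin (λ j → w G i j * z j))   ≡⟨ sumFin-comm (λ i j → w G i j * z j) ⟩
    sumFin (λ j → sumFin (λ i → w G i j * z j))   ≡⟨ sumFin-cong (λ j → sumFin-*ʳ (z j) (λ i → w G i j)) ⟩
    sumFin (λ j → sumFin (λ i → w G i j) * z j)   ≡⟨ sumFin-cong (λ j → cong (_* z j) (sumFin-cong (λ i → w-sym G i j))) ⟩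
    dot d z                                       ∎

  lazyWalk-laplacian : ∀ i j → lazyWalk L i j ≡ ½ * (δ i j + inv (d i) * w G i j)
  lazyWalk-laplacian i j = cong₂ (λ dᵢ wᵢⱼ → ½ * (δ i j + inv dᵢ * wᵢⱼ)) (laplacian-diag i) (offDiagAT-laplacian i j)

  lazyWalk-diag : ∀ i → lazyWalk L i i ≡ ½
  lazyWalk-diag i = begin-equality
    lazyWalk L i i                       ≡⟨ lazyWalk-laplacian i i ⟩
    ½ * (δ i i + inv (d i) * w G i i)    ≡⟨ cong₂ (λ δᵢᵢ wᵢᵢ → ½ * (δᵢᵢ + inv (d i) * wᵢᵢ)) (δ-refl i) (w-diag G i) ⟩
    ½ * (1ℚ + inv (d i) * 0ℚ)            ≡⟨ solve 1 (λ a → con ½ :* (con 1ℚ :+ a :* con 0ℚ) := con ½) refl (inv (d i)) ⟩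
    ½                                    ∎

module StochasticMatrix {n : ℕ} (T : Mat n) (T-nonNeg : ∀ i j → 0ℚ ≤ T i j) (T-rowSum : ∀ i → sumFin (T i) ≡ 1ℚ) where

  ·v-excess : ∀ z c i → sumFin (λ j → T i j * (z j - c)) ≡ (T ·v z) i - c
  ·v-excess z c i = begin-equality
    sumFin (λ j → T i j * (z j - c))            ≡⟨ sumFin-cong (λ j → *-distribˡ-+ (T i j) (z j) (- c)) ⟩
    sumFin (λ j → T i j * z j + T i j * - c)    ≡⟨ sumFin-+ (λ j → T i j * z j) (λ j → T i j * - c) ⟩
    (T ·v z) i + sumFin (λ j → T i j * - c)     ≡⟨ cong ((T ·v z) i +_) (sumFin-*ʳ (- c) (T i)) ⟩
    (T ·v z) i + sumFin (T i) * - c             ≡⟨ cong (λ r → (T ·v z) i + r * - c) (T-rowSum i) ⟩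
    (T ·v z) i + 1ℚ * - c                       ≡⟨ cong ((T ·v z) i +_) (*-identityˡ (- c)) ⟩
    (T ·v z) i - c                              ∎

  entry-excess≤ : ∀ {z lo} → (∀ j → lo ≤ z j) → ∀ i j → T i j * (z j - lo) ≤ (T ·v z) i - lo
  entry-excess≤ {z} {lo} lo≤z i j = subst (T i j * (z j - lo) ≤_) (·v-excess z lo i)
    (term≤sumFin (λ k → *-nonNeg (T-nonNeg i k) (p≤q⇒0≤q-p (lo≤z k))) j)

  ·v-lower : ∀ {z lo} → (∀ j → lo ≤ z j) → ∀ i → lo ≤ (T ·v z) i
  ·v-lower {z} {lo} lo≤z i = 0≤q-p⇒p≤q (subst (0ℚ ≤_) (·v-excess z lo i)
    (sumFin-nonNeg (λ j → *-nonNeg (T-nonNeg i j) (p≤q⇒0≤q-p (lo≤z j)))))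

  pow·-lower : ∀ {z lo} → (∀ j → lo ≤ z j) → ∀ k i → lo ≤ pow· T k z i
  pow·-lower lo≤z zero    = lo≤z
  pow·-lower lo≤z (suc k) = ·v-lower (pow·-lower lo≤z k)

  pow·-upper : ∀ {z hi} → (∀ j → z j ≤ hi) → ∀ k i → pow· T k z i ≤ hi
  pow·-upper {z} {hi} z≤hi k i =
    ≤-by-difference (pow·-lower {z = λ j → - z j} (λ j → neg-antimono-≤ (z≤hi j)) k i)
                    (trans (cong (λ r → r - - hi) (pow·-neg T k z i)) (solve 2 (λ p h → :- p :- :- h := h :- p) refl (pow· T k z i) hi))

  pow·-within : ∀ {z lo hi} → Within lo hi z → ∀ k → Within lo hi (pow· T k z)
  pow·-within within k i = pow·-lower (proj₁ ∘ within) k i , pow·-upper (proj₂ ∘ within) k i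

module LazyWalk {n : ℕ} (G : Graph n) (deg-pos : ∀ i → 0ℚ < deg G i) where

  open GraphLaplacian G

  private
    L = laplacian G
    T = lazyWalk L
    d = deg G
    a : Fin n → ℚ
    a i = inv (deg G i)

  inv-deg*deg : ∀ i → a i * d i ≡ 1ℚ
  inv-deg*deg i = inv-inverseˡ (pos⇒≢0 (deg-pos i))

  lazyWalk-·v : ∀ z i → (T ·v z) i ≡ ½ * z i + ½ * (a i * (adj G ·v z) i)
  lazyWalk-·v z i = begin-equality
    sumFin (λ j → T i j * z j)                                      ≡⟨ sumFin-cong (λ j → cong (_* z j) (lazyWalk-laplacian i j)) ⟩
    sumFin (λ j → ½ * (δ i j + a i * w G i j) * z j)                ≡⟨ sumFin-cong (λ j → expand (δ i j) (a i) (w G i j) (z j)) ⟩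
    sumFin (λ j → ½ * (δ i j * z j) + ½ * a i * (w G i j * z j))    ≡⟨ sumFin-+ (λ j → ½ * (δ i j * z j)) (λ j → ½ * a i * (w G i j * z j)) ⟩
    sumFin (λ j → ½ * (δ i j * z j)) + sumFin (λ j → ½ * a i * (w G i j * z j))
      ≡⟨ cong₂ _+_ (trans (sumFin-*ˡ ½ (λ j → δ i j * z j)) (cong (½ *_) (sumFin-δ i z)))
                   (trans (sumFin-*ˡ (½ * a i) (λ j → w G i j * z j)) (*-assoc ½ (a i) _)) ⟩
    ½ * z i + ½ * (a i * (adj G ·v z) i)                            ∎
    where
    expand : ∀ δ a w z → ½ * (δ + a * w) * z ≡ ½ * (δ * z) + ½ * a * (w * z)
    expand = solve 4 (λ δ a w z → con ½ :* (δ :+ a :* w) :* z := con ½ :* (δ :* z) :+ con ½ :* a :* (w :* z)) refl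

  lazyWalk-·v-laplacian : ∀ z i → (T ·v z) i ≡ z i - ½ * (a i * (L ·v z) i)
  lazyWalk-·v-laplacian z i = begin-equality
    (T ·v z) i                                                    ≡⟨ lazyWalk-·v z i ⟩
    ½ * z i + ½ * (a i * Az)                                      ≡⟨ regroup (a i) (d i) (z i) Az ⟩
    z i - ½ * (a i * (d i * z i - Az)) + ½ * (a i * d i - 1ℚ) * z i ≡⟨ cong (λ r → z i - ½ * (a i * (d i * z i - Az)) + ½ * (r - 1ℚ) * z i) (inv-deg*deg i) ⟩
    z i - ½ * (a i * (d i * z i - Az)) + ½ * (1ℚ - 1ℚ) * z i     ≡⟨ solve 2 (λ x z → x :+ con ½ :* (con 1ℚ :- con 1ℚ) :* z := x) refl _ (z i) ⟩
    z i - ½ * (a i * (d i * z i - Az))                            ≡⟨ cong (λ r → z i - ½ * (a i * r)) (laplacian-·v z i) ⟨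
    z i - ½ * (a i * (L ·v z) i)                                  ∎
    where
    Az = (adj G ·v z) i
    regroup : ∀ a d z Az → ½ * z + ½ * (a * Az) ≡ z - ½ * (a * (d * z - Az)) + ½ * (a * d - 1ℚ) * z
    regroup = solve 4 (λ a d z Az → con ½ :* z :+ con ½ :* (a :* Az) := z :- con ½ :* (a :* (d :* z :- Az)) :+ con ½ :* (a :* d :- con 1ℚ) :* z) refl

  lazyWalk-nonNeg : ∀ i j → 0ℚ ≤ T i j
  lazyWalk-nonNeg i j = subst (0ℚ ≤_) (sym (lazyWalk-laplacian i j))
    (*-nonNeg (nonNegative⁻¹ ½) (+-mono-≤ (δ-nonNeg i j) (*-nonNeg (<⇒≤ (inv-pos (deg-pos i))) (w-nonneg G i j))))

  lazyWalk-edge-pos : ∀ {i j} → 0ℚ < w G i j → 0ℚ < T i j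
  lazyWalk-edge-pos {i} {j} 0<wᵢⱼ = subst (0ℚ <_) (sym (lazyWalk-laplacian i j))
    (*-pos (positive⁻¹ ½) (+-mono-≤-< (δ-nonNeg i j) (*-pos (inv-pos (deg-pos i)) 0<wᵢⱼ)))

  lazyWalk-rowSum : ∀ i → sumFin (T i) ≡ 1ℚ
  lazyWalk-rowSum i = begin-equality
    sumFin (T i)                                  ≡⟨ sumFin-cong (λ j → sym (*-identityʳ (T i j))) ⟩
    (T ·v (λ _ → 1ℚ)) i                           ≡⟨ lazyWalk-·v (λ _ → 1ℚ) i ⟩
    ½ * 1ℚ + ½ * (a i * (adj G ·v (λ _ → 1ℚ)) i)  ≡⟨ cong (λ r → ½ * 1ℚ + ½ * (a i * r)) (sumFin-cong (λ j → *-identityʳ (w G i j))) ⟩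
    ½ * 1ℚ + ½ * (a i * d i)                      ≡⟨ cong (λ r → ½ * 1ℚ + ½ * r) (inv-deg*deg i) ⟩
    1ℚ                                            ∎

  lazyWalk-preserves-degree-mean : ∀ z → dot d (T ·v z) ≡ dot d z
  lazyWalk-preserves-degree-mean z = begin-equality
    sumFin (λ i → d i * (T ·v z) i)                                  ≡⟨ sumFin-cong (λ i → cong (d i *_) (lazyWalk-·v z i)) ⟩
    sumFin (λ i → d i * (½ * z i + ½ * (a i * Az i)))                ≡⟨ sumFin-cong (λ i → regroup (d i) (z i) (a i) (Az i)) ⟩
    sumFin (λ i → ½ * (d i * z i) + ½ * ((a i * d i) * Az i))        ≡⟨ sumFin-cong (λ i → cong (λ r → ½ * (d i * z i) + ½ * (r * Az i)) (inv-deg*deg i)) ⟩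
    sumFin (λ i → ½ * (d i * z i) + ½ * (1ℚ * Az i))                 ≡⟨ sumFin-+ (λ i → ½ * (d i * z i)) (λ i → ½ * (1ℚ * Az i)) ⟩
    sumFin (λ i → ½ * (d i * z i)) + sumFin (λ i → ½ * (1ℚ * Az i)) ≡⟨ cong₂ _+_ (sumFin-*ˡ ½ (λ i → d i * z i)) (sumFin-*ˡ ½ (λ i → 1ℚ * Az i)) ⟩
    ½ * dot d z + ½ * sumFin (λ i → 1ℚ * Az i)                       ≡⟨ cong (λ r → ½ * dot d z + ½ * r) (sumFin-cong (λ i → *-identityˡ (Az i))) ⟩
    ½ * dot d z + ½ * sumFin Az                                      ≡⟨ cong (λ r → ½ * dot d z + ½ * r) (sumFin-adj-·v z) ⟩
    ½ * dot d z + ½ * dot d z                                        ≡⟨ solve 1 (λ m → con ½ :* m :+ con ½ :* m := m) refl (dot d z) ⟩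
    dot d z                                                          ∎
    where
    Az = adj G ·v z
    regroup : ∀ d z a Az → d * (½ * z + ½ * (a * Az)) ≡ ½ * (d * z) + ½ * ((a * d) * Az)
    regroup = solve 4 (λ d z a Az → d :* (con ½ :* z :+ con ½ :* (a :* Az)) := con ½ :* (d :* z) :+ con ½ :* ((a :* d) :* Az)) refl

  pow·-preserves-degree-mean : ∀ z k → dot d (pow· T k z) ≡ dot d z
  pow·-preserves-degree-mean z zero    = refl
  pow·-preserves-degree-mean z (suc k) = trans (lazyWalk-preserves-degree-mean (pow· T k z)) (pow·-preserves-degree-mean z k)

  lazyWalk-solution : ∀ {b x} → (∀ i → (L ·v x) i ≡ b i) → ∀ i → (T ·v x) i ≡ x i - ½ * Dinv· L b i
  lazyWalk-solution {b} {x} Lx≡b i = begin-equality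
    (T ·v x) i                         ≡⟨ lazyWalk-·v-laplacian x i ⟩
    x i - ½ * (a i * (L ·v x) i)       ≡⟨ cong (λ r → x i - ½ * (a i * r)) (Lx≡b i) ⟩
    x i - ½ * (a i * b i)              ≡⟨ cong (λ r → x i - ½ * (inv r * b i)) (laplacian-diag i) ⟨
    x i - ½ * Dinv· L b i              ∎

-- Mixing of the lazy walk on a connected graph

module ConnectedGraph {n : ℕ} (G : Graph n) (deg-pos : ∀ i → 0ℚ < deg G i) (conn : Connected G) (s : Fin n) where

  open GraphLaplacian G
  open LazyWalk G deg-pos
  private
    L = laplacian G
    T = lazyWalk L
  open StochasticMatrix T lazyWalk-nonNeg lazyWalk-rowSum

  q : ℚ
  q = proj₁ (positive-lower-boundᴹ T)

  0<q : 0ℚ < q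
  0<q = proj₁ (proj₂ (positive-lower-boundᴹ T))

  q≤lazyWalk : ∀ i j → 0ℚ < T i j → q ≤ T i j
  q≤lazyWalk = proj₂ (proj₂ (positive-lower-boundᴹ T))

  0<lazyWalk-diag : ∀ i → 0ℚ < T i i
  0<lazyWalk-diag i = subst (0ℚ <_) (sym (lazyWalk-diag i)) (positive⁻¹ ½)

  length : ∀ {i j} → Reachable G i j → ℕ
  length here       = 0
  length (step _ r) = suc (length r)

  excess-step : ∀ {z lo} → (∀ j → lo ≤ z j) → ∀ i j → 0ℚ < T i j → ∀ k {B} →
                B ≤ pow· T k z j - lo → q * B ≤ pow· T (suc k) z i - lo
  excess-step {z} {lo} lo≤z i j 0<Tᵢⱼ k {B} B≤ = begin
    q * B                            ≤⟨ *-monoˡ-≤-0≤ (<⇒≤ 0<q) B≤ ⟩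
    q * (pow· T k z j - lo)          ≤⟨ *-monoʳ-≤-nonNeg _ {{nonNegative (p≤q⇒0≤q-p (pow·-lower lo≤z k j))}} (q≤lazyWalk i j 0<Tᵢⱼ) ⟩
    T i j * (pow· T k z j - lo)      ≤⟨ entry-excess≤ (pow·-lower lo≤z k) i j ⟩
    pow· T (suc k) z i - lo          ∎

  -- A path shorter than k is padded with idle steps, which laziness (T i i = ½) makes as good as edges.
  path-bound : ∀ {i z lo} (r : Reachable G i s) k → length r ℕ.≤ k → (∀ j → lo ≤ z j) →
               q ^ k * (z s - lo) ≤ pow· T k z i - lo
  path-bound here zero _ _ = ≤-reflexive (*-identityˡ _)
  path-bound {i} here (suc k) _ lo≤z =
    ≤-trans (≤-reflexive (*-assoc q (q ^ k) _)) (excess-step lo≤z i i (0<lazyWalk-diag i) k (path-bound here k z≤n lo≤z))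
  path-bound {i} (step {j = j} 0<wᵢⱼ r) (suc k) (s≤s len≤k) lo≤z =
    ≤-trans (≤-reflexive (*-assoc q (q ^ k) _)) (excess-step lo≤z i j (lazyWalk-edge-pos 0<wᵢⱼ) k (path-bound r k len≤k lo≤z))

  K : ℕ
  K = proj₁ (ℕ-bounded (λ i → length (conn i s)))

  c : ℚ
  c = q ^ K

  0<c : 0ℚ < c
  0<c = ^-pos 0<q K

  c≤1 : c ≤ 1ℚ
  c≤1 = ^-≤1 (<⇒≤ 0<q) (≤-trans q≤½ (<⇒≤ ½<1)) K
    where
    q≤½ : q ≤ ½
    q≤½ = subst (q ≤_) (lazyWalk-diag s) (q≤lazyWalk s s (0<lazyWalk-diag s))

  contraction : ∀ {lo hi z} → Within lo hi z → Within (lo + c * (z s - lo)) (hi - c * (hi - z s)) (pow· T K z)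
  contraction {lo} {hi} {z} within i = raised-lower , lowered-upper
    where
    K-bound : ∀ {y lo} → (∀ j → lo ≤ y j) → c * (y s - lo) ≤ pow· T K y i - lo
    K-bound = path-bound (conn i s) K (proj₂ (ℕ-bounded (λ i → length (conn i s))) i)
    raised-lower : lo + c * (z s - lo) ≤ pow· T K z i
    raised-lower = ≤-by-difference (K-bound (proj₁ ∘ within))
      (solve 4 (λ p lo c zs → (p :- lo) :- c :* (zs :- lo) := p :- (lo :+ c :* (zs :- lo))) refl (pow· T K z i) lo c (z s))
    lowered-upper : pow· T K z i ≤ hi - c * (hi - z s)
    lowered-upper = ≤-by-difference (K-bound {y = λ j → - z j} (λ j → neg-antimono-≤ (proj₂ (within j))))
      (trans (cong (λ r → r - - hi - c * (- z s - - hi)) (pow·-neg T K z i))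
             (solve 4 (λ p hi c zs → (:- p :- :- hi) :- c :* (:- zs :- :- hi) := (hi :- c :* (hi :- zs)) :- p) refl (pow· T K z i) hi c (z s)))

  contraction-iterated : ∀ {lo hi z} → Within lo hi z → ∀ j →
    ∃₂ λ lo′ hi′ → Within lo′ hi′ (pow· T (j ℕ.* K) z) × hi′ - lo′ ≡ (1ℚ - c) ^ j * (hi - lo)
  contraction-iterated {lo} {hi} within zero = lo , hi , within , sym (*-identityˡ (hi - lo))
  contraction-iterated {lo} {hi} {z} within (suc j) with contraction-iterated within j
  ... | lo′ , hi′ , within′ , width′ = lo′ + c * (y s - lo′) , hi′ - c * (hi′ - y s) , within″ , width″
    where
    y = pow· T (j ℕ.* K) z
    within″ : Within (lo′ + c * (y s - lo′)) (hi′ - c * (hi′ - y s)) (pow· T (suc j ℕ.* K) z)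
    within″ i = subst (λ p → lo′ + c * (y s - lo′) ≤ p × p ≤ hi′ - c * (hi′ - y s))
                      (sym (pow·-+ T K (j ℕ.* K) z i)) (contraction within′ i)
    shrink : ∀ h l c y → h - c * (h - y) - (l + c * (y - l)) ≡ (1ℚ - c) * (h - l)
    shrink = solve 4 (λ h l c y → h :- c :* (h :- y) :- (l :+ c :* (y :- l)) := (con 1ℚ :- c) :* (h :- l)) refl
    width″ : hi′ - c * (hi′ - y s) - (lo′ + c * (y s - lo′)) ≡ (1ℚ - c) ^ suc j * (hi - lo)
    width″ = begin-equality
      hi′ - c * (hi′ - y s) - (lo′ + c * (y s - lo′))  ≡⟨ shrink hi′ lo′ c (y s) ⟩
      (1ℚ - c) * (hi′ - lo′)                          ≡⟨ cong ((1ℚ - c) *_) width′ ⟩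
      (1ℚ - c) * ((1ℚ - c) ^ j * (hi - lo))           ≡⟨ *-assoc (1ℚ - c) ((1ℚ - c) ^ j) (hi - lo) ⟨
      (1ℚ - c) ^ suc j * (hi - lo)                    ∎

  0<Σdeg : 0ℚ < sumFin (deg G)
  0<Σdeg = <-≤-trans (deg-pos s) (term≤sumFin (λ i → <⇒≤ (deg-pos i)) s)

  centred-powers-bounded : ∀ {y lo hi} → dot (deg G) y ≡ 0ℚ → Within lo hi y → ∀ m i → ∣ pow· T m y i ∣ ≤ hi - lo
  centred-powers-bounded {y} dy≡0 within m i = ∣p∣≤q-r (proj₁ bounds) (proj₂ bounds) (proj₁ (within′ i)) (proj₂ (within′ i))
    where
    within′ = pow·-within within m
    bounds = weighted-mean-zero⇒lo≤0≤hi (λ i → <⇒≤ (deg-pos i)) 0<Σdeg (trans (pow·-preserves-degree-mean y m) dy≡0) within′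

  powers-shrink : ∀ {y lo hi} → dot (deg G) y ≡ 0ℚ → Within lo hi y →
                  ∀ j k → j ℕ.* K ℕ.≤ k → ∀ i → ∣ pow· T k y i ∣ ≤ (1ℚ - c) ^ j * (hi - lo)
  powers-shrink {y} {lo} {hi} dy≡0 within j k jK≤k i =
    let (lo′ , hi′ , within′ , width′) = contraction-iterated within j in begin
      ∣ pow· T k y i ∣                                 ≡⟨ cong (λ m → ∣ pow· T m y i ∣) (ℕ.m∸n+n≡m jK≤k) ⟨
      ∣ pow· T (k ℕ.∸ j ℕ.* K ℕ.+ j ℕ.* K) y i ∣       ≡⟨ cong ∣_∣ (pow·-+ T (k ℕ.∸ j ℕ.* K) (j ℕ.* K) y i) ⟩
      ∣ pow· T (k ℕ.∸ j ℕ.* K) (pow· T (j ℕ.* K) y) i ∣ ≤⟨ centred-powers-bounded mean≡0 within′ (k ℕ.∸ j ℕ.* K) i ⟩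
      hi′ - lo′                                        ≡⟨ width′ ⟩
      (1ℚ - c) ^ j * (hi - lo)                         ∎
    where
    mean≡0 : dot (deg G) (pow· T (j ℕ.* K) y) ≡ 0ℚ
    mean≡0 = trans (pow·-preserves-degree-mean y (j ℕ.* K)) dy≡0

  powers-vanish : ∀ {y} → dot (deg G) y ≡ 0ℚ → ConvergesTo (λ k → pow· T k y) (λ _ → 0ℚ)
  powers-vanish {y} dy≡0 ε 0<ε =
    let (lo , hi , within) = ℚ-bounded y
        (j , shrunk) = geometric-eventually-≤ {W = hi - lo} 0<c c≤1 (*-pos (positive⁻¹ ½) 0<ε)
    in j ℕ.* K , λ k jK≤k i → begin-strict
      ∣ pow· T k y i - 0ℚ ∣         ≡⟨ cong ∣_∣ (+-identityʳ (pow· T k y i)) ⟩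
      ∣ pow· T k y i ∣              ≤⟨ powers-shrink dy≡0 within j k jK≤k i ⟩
      (1ℚ - c) ^ j * (hi - lo)      ≤⟨ shrunk ⟩
      ½ * ε                         <⟨ ½*p<p 0<ε ⟩
      ε                             ∎

  -- u - κ is a fixed point of T with degree-weighted mean 0, hence equal to the limit 0 of its powers.
  laplacian-kernel-constant : ∀ {u} → (∀ i → (L ·v u) i ≡ 0ℚ) → ∀ i → u i ≡ weighted-centre (deg G) u
  laplacian-kernel-constant {u} Lu≡0 i = begin-equality
    u i             ≡⟨ solve 2 (λ u κ → u := (u :- κ) :+ κ) refl (u i) κ ⟩
    u′ i + κ        ≡⟨ cong (_+ κ) (constant-limit {x = u′} {y = λ _ → 0ℚ} u′-vanishes i) ⟩
    0ℚ + κ          ≡⟨ +-identityˡ κ ⟩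
    κ               ∎
    where
    κ = weighted-centre (deg G) u
    u′ : Vec n
    u′ j = u j - κ
    Tu′≡u′ : ∀ j → (T ·v u′) j ≡ u′ j
    Tu′≡u′ j = begin-equality
      (T ·v u′) j                                  ≡⟨ lazyWalk-·v-laplacian u′ j ⟩
      u′ j - ½ * (inv (deg G j) * (L ·v u′) j)     ≡⟨ cong (λ r → u′ j - ½ * (inv (deg G j) * r)) (trans (laplacian-·v-shift u κ j) (Lu≡0 j)) ⟩
      u′ j - ½ * (inv (deg G j) * 0ℚ)              ≡⟨ solve 2 (λ x a → x :- con ½ :* (a :* con 0ℚ) := x) refl (u′ j) (inv (deg G j)) ⟩
      u′ j                                         ∎
    u′-vanishes : ConvergesTo (λ _ → u′) (λ _ → 0ℚ)
    u′-vanishes = ConvergesTo-by-distance {s = λ _ → u′} {λ m → pow· T m u′} {λ _ → 0ℚ} {λ _ → 0ℚ}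
      (λ m j → cong (λ p → ∣ p - 0ℚ ∣) (sym (pow·-fixed T Tu′≡u′ m j)))
      (powers-vanish (dot-centred≡0 (deg G) u (pos⇒≢0 0<Σdeg)))

  laplacian-·v-pseudoInverse : ∀ {P} → IsPseudoInverse L P → ∀ {v} → sumFin v ≡ 0ℚ → ∀ i → (L ·v (P ·v v)) i ≡ v i
  laplacian-·v-pseudoInverse {P} pinv {v} Σv≡0 i = begin-equality
    LPv i                   ≡⟨ solve 2 (λ v x → x := v :- (v :- x)) refl (v i) (LPv i) ⟩
    v i - u i               ≡⟨ cong (λ r → v i - r) (trans (laplacian-kernel-constant Lu≡0 i) κ≡0) ⟩
    v i - 0ℚ                ≡⟨ +-identityʳ (v i) ⟩
    v i                     ∎
    where
    LPv = L ·v (P ·v v)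
    u : Vec n
    u j = v j - LPv j
    κ = weighted-centre (deg G) u
    Lu≡0 : ∀ k → (L ·v u) k ≡ 0ℚ
    Lu≡0 k = begin-equality
      (L ·v u) k                  ≡⟨ ·v-sub L v LPv k ⟩
      (L ·v v) k - (L ·v LPv) k   ≡⟨ cong (λ r → (L ·v v) k - r) (·v-congʳ L (·v-·m L P v) k) ⟩
      (L ·v v) k - (L ·v ((L ·m P) ·v v)) k ≡⟨ cong (λ r → (L ·v v) k - r) (·v-·m L (L ·m P) v k) ⟩
      (L ·v v) k - ((L ·m (L ·m P)) ·v v) k ≡⟨ cong (λ r → (L ·v v) k - r) (·v-congˡ v (symmetric-pseudoInverse laplacian-sym pinv) k) ⟩
      (L ·v v) k - (L ·v v) k     ≡⟨ +-inverseʳ ((L ·v v) k) ⟩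
      0ℚ                          ∎
    Σ1 : ℚ
    Σ1 = sumFin {n} (λ _ → 1ℚ)
    0<Σ1 : 0ℚ < Σ1
    0<Σ1 = <-≤-trans (positive⁻¹ 1ℚ) (term≤sumFin (λ _ → nonNegative⁻¹ 1ℚ) s)
    κ≡0 : κ ≡ 0ℚ
    κ≡0 = *-cancelˡ-≡-pos 0<Σ1 (begin-equality
      Σ1 * κ                   ≡⟨ sumFin-*ʳ {n} κ (λ _ → 1ℚ) ⟨
      sumFin {n} (λ _ → 1ℚ * κ) ≡⟨ sumFin-cong (λ j → trans (*-identityˡ κ) (sym (laplacian-kernel-constant Lu≡0 j))) ⟩
      sumFin u                 ≡⟨ sumFin-- v LPv ⟩
      sumFin v - sumFin LPv    ≡⟨ cong₂ _-_ Σv≡0 (sumFin-laplacian-·v (P ·v v)) ⟩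
      0ℚ - 0ℚ                  ≡⟨ *-zeroʳ Σ1 ⟨
      Σ1 * 0ℚ                  ∎)

  centred-solution-is-series-sum : ∀ {b x} → (∀ i → (L ·v x) i ≡ b i) → dot (deg G) x ≡ 0ℚ → IsSeriesSum L b x
  centred-solution-is-series-sum {b} {x} Lx≡b dx≡0 =
    ConvergesTo-by-distance {s = partialSum L b} {λ m → pow· T m x} {x} {λ _ → 0ℚ} distance (powers-vanish dx≡0)
    where
    distance : ∀ m i → ∣ partialSum L b m i - x i ∣ ≡ ∣ pow· T m x i - 0ℚ ∣
    distance m i = begin-equality
      ∣ partialSum L b m i - x i ∣             ≡⟨ cong (λ p → ∣ p - x i ∣) (partialSum-telescopes L b x (lazyWalk-solution Lx≡b) m i) ⟩
      ∣ x i - pow· T m x i - x i ∣             ≡⟨ cong ∣_∣ (solve 2 (λ x p → x :- p :- x := :- (p :- con 0ℚ)) refl (x i) (pow· T m x i)) ⟩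
      ∣ - (pow· T m x i - 0ℚ) ∣                ≡⟨ ∣-p∣≡∣p∣ (pow· T m x i - 0ℚ) ⟩
      ∣ pow· T m x i - 0ℚ ∣                    ∎

another-vertex : ∀ {n} → 2 ℕ.≤ n → (i : Fin n) → ∃ λ j → i ≢ j
another-vertex (s≤s (s≤s z≤n)) zero    = suc zero , λ ()
another-vertex (s≤s (s≤s z≤n)) (suc _) = zero , λ ()

lemma9p1 : ∀ (n : ℕ) → 2 ℕ.≤ n → (G : Graph n) → Connected G →
    (s t : Fin n) → s ≢ t →
    (P : Mat n) → IsPseudoInverse (laplacian G) P →
    InRange (laplacian G) (chi s t) ×
      ∃ λ (xstar : Vec n) → IsSeriesSum (laplacian G) (chi s t) xstar ×
        dot (chi s t) xstar ≡ effRes P s t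
lemma9p1 n 2≤n G conn s t _ P pinv =
  (Pb , LPb≡b) , xstar , centred-solution-is-series-sum Lxstar≡b centred , dot-sub-const b Pb κ (sumFin-chi s t)
  where
  -- With n ≥ 2 every vertex reaches some other vertex, so its degree is positive and
  -- inv (deg G i) is a genuine inverse rather than the junk value inv 0ℚ = 0ℚ.
  deg-pos : ∀ i → 0ℚ < deg G i
  deg-pos i = let (j , i≢j) = another-vertex 2≤n i in reachable-distinct⇒deg-pos G (conn i j) i≢j
  open GraphLaplacian G
  open ConnectedGraph G deg-pos conn s
  b = chi s t
  Pb = P ·v b
  κ = weighted-centre (deg G) Pb
  xstar : Vec n
  xstar i = Pb i - κ
  LPb≡b : ∀ i → (laplacian G ·v Pb) i ≡ b i
  LPb≡b = laplacian-·v-pseudoInverse pinv (sumFin-chi s t)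
  Lxstar≡b : ∀ i → (laplacian G ·v xstar) i ≡ b i
  Lxstar≡b i = trans (laplacian-·v-shift Pb κ i) (LPb≡b i)
  centred : dot (deg G) xstar ≡ 0ℚ
  centred = dot-centred≡0 (deg G) Pb (pos⇒≢0 0<Σdeg)
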